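{- Let $MPF$ be a valley-marked parking function, $c$ a car not in $MPF$, and $k\ge0$ such that the $k$-diagonal of $MPF$ contains no marked car smaller than $c$. Then $$\sum_{MPF' \in \operatorname{Insert}^{*}(MPF,c,k)} t^{\operatorname{area}(MPF')} q^{\operatorname{dinv}(MPF')} = t^{\operatorname{area}(MPF)+k} q^{\operatorname{dinv}(MPF)} \big[\, |\operatorname{Insert}^{*}(MPF,c,k)| \,\big]_q,$$ where $[m]_q = 1+q+\dots+q^{m-1}$ (and $[0]_q=0$).
   Context: A Dyck path of size $n$ is a lattice path from $(0,0)$ to $(n,n)$ with unit North and East steps staying weakly above $y=x$. A parking function is a Dyck path with distinct positive integer "cars", one in the cell immediately right of each North step, increasing bottom to top in each column. The cell with lower-left corner $(i,j)$ lies in the $(j-i)$-diagonal. "Left/right" for cars refers to their columns. $\operatorname{area}$ is the number of full cells between the path and $y=x$. A valley is an East step immediately followed by a North step such that either the cell directly below the East step contains no car, or it contains a car smaller than the car next to that North step. A valley-marked parking function is a parking function with a subset of its valleys marked; the car next to the North step of a marked valley is called marked. For cars $s<b$: they form a primary diagonal inversion if they lie in the same diagonal, $s$ is to the left of $b$, and $s$ is unmarked; they form a secondary diagonal inversion if $b$ is in the diagonal one above that of $s$, $b$ is to the left of $s$, and $b$ is unmarked. $\operatorname{dinv}(MPF)$ is the number of primary and secondary diagonal inversions minus the number of marked valleys. Insertion $\operatorname{Insert}^{*}(MPF,c,k)$ (defined when $c$ is not in $MPF$ and the $k$-diagonal of $MPF$ contains no marked car smaller than $c$): for each unmarked car $s<c$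 in the $k$-diagonal of $MPF$ and each unmarked car $b>c$ in the $(k+1)$-diagonal, create one new marked parking function by inserting a marked car $c$ as follows. Look to the right of this unmarked car $s$ or $b$ for the next time that either an unmarked car $b'>c$ appears in the $(k+1)$-diagonal or the underlying Dyck path returns to the line $y=x+k$ (for a car $s<c$ with nothing directly above it, the latter happens immediately). If one first encounters an unmarked car $b'>c$ in the $(k+1)$-diagonal, shift $b'$ and every car in a higher row up and to the right by one and place the marked car $c$ directly under $b'$. If one first encounters a place where the path returns to $y=x+k$, move all cars above this point up and to the right by one and place the marked car $c$ in the cell directly to the right of and above this point, so that it lies in the $k$-diagonal. $\operatorname{Insert}^{*}(MPF,c,k)$ is the set of all marked parking functions so created. -}

module Defs where

open import Data.Nat using (ℕ; zero; suc; _+_; _≤_; _<_; _≟_; _<?_; _≤?_)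
open import Data.Bool using (Bool; true; false; if_then_else_; _∧_; _∨_; not)
open import Data.Nat.ListAction using (sum)
open import Data.List using (List; []; _∷_; map; length; take; drop; _++_; upTo)
open import Data.List.Relation.Unary.All using (All)
open import Data.List.Relation.Unary.Linked using (Linked)
open import Data.List.Relation.Unary.Unique.Propositional using (Unique)
open import Data.Integer as ℤ using (ℤ)
open import Data.Product using (_×_; _,_)
open import Data.Sum using (_⊎_)
open import Data.Unit using (⊤)
open import Relation.Binary.PropositionalEquality using (_≡_)
open import Relation.Nullary.Decidable using (⌊_⌋)

-- A parking function is stored as the list of its rows, bottom to top
-- (row i = the i-th North step, i = 0 .. n-1).  Row i records
--   * car    : the car in the cell immediately right of the i-th North step,
--   * diag   : the diagonal a_i of that cell (cell with lower-left corner
--              (x_i , i) lies in the (i - x_i)-diagonal, so x_i = i - a_i),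
--   * marked : whether this row's North step is a marked valley (i.e. the
--              car is marked).
-- The Dyck path is determined by the diagonals (a_0 = 0, a_{i+1} ≤ a_i + 1),
-- and area = Σ a_i.

record Row : Set where
  constructor row
  field
    car    : ℕ
    diag   : ℕ
    marked : Bool

open Row public

-- Row q (directly after row p) is at a valley: its North step is preceded
-- by an East step (diag q ≤ diag p) and the cell below that East step is
-- either empty (diag q < diag p) or contains a car (that of p, when
-- diag q ≡ diag p) smaller than the car of q.
IsValley : Row → Row → Set
IsValley p q = diag q < diag p ⊎ (diag q ≡ diag p × car p < car q)

Step : Row → Row → Set
Step p q =
  (diag q ≤ suc (diag p)) ×                      -- Dyck path condition
  (diag q ≡ suc (diag p) → car p < car q) ×      -- same column: cars increase upward
  (marked q ≡ true → IsValley p q)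

-- The bottom row starts at the origin (diagonal 0) and is never a valley.
StartOK : List Row → Set
StartOK []      = ⊤
StartOK (r ∷ _) = diag r ≡ 0 × marked r ≡ false

record IsMPF (rs : List Row) : Set where
  field
    positive : All (λ r → 1 ≤ car r) rs
    distinct : Unique (map car rs)
    start    : StartOK rs
    steps    : Linked Step rs

area : List Row → ℕ
area rs = sum (map diag rs)

-- contribution of a pair (lower row r, upper row s).
--  primary:   same diagonal, smaller car in lower row (= to the left), lower
--             (smaller) car unmarked;
--  secondary: lower row r is in the diagonal one above that of s
--             (then r is to the left of s), car r > car s, r unmarked.
pairDinv : Row → Row → ℕ
pairDinv r s =
  if marked r then 0 else
    ((if ⌊ diag r ≟ diag s ⌋ ∧ ⌊ car r <? car s ⌋ then 1 else 0)
     + (if ⌊ diag r ≟ suc (diag s) ⌋ ∧ ⌊ car s <? car r ⌋ then 1 else 0))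

diagInv : List Row → ℕ
diagInv []       = 0
diagInv (r ∷ rs) = sum (map (pairDinv r) rs) + diagInv rs

markedValleys : List Row → ℕ
markedValleys []       = 0
markedValleys (r ∷ rs) = (if marked r then 1 else 0) + markedValleys rs

dinv : List Row → ℤ
dinv rs = ℤ.+ diagInv rs ℤ.- ℤ.+ markedValleys rs

-- insert a row at position i (it becomes the i-th row; rows ≥ i move up
-- and to the right by one, keeping their diagonals).
insRow : ℕ → Row → List Row → List Row
insRow i x xs = take i xs ++ (x ∷ drop i xs)

-- Scanning to the right of a starting car.  Arguments: k, c, the diagonal
-- a of the previous row, the index i of the next row, the remaining rows.
-- Between the North step of row i-1 and that of row i the path passes
-- through the diagonal values a+1, a, ..., diag(row i); so it returns to
-- y = x + k there iff diag(row i) ≤ k ≤ a+1 (this point is at height i,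
-- and c is then placed as new row i in the k-diagonal).  Otherwise if row i
-- holds an unmarked car b' > c in the (k+1)-diagonal, c is placed directly
-- under b', i.e. again as new row i in the k-diagonal.  After the last row
-- the path goes down to y = x, hence returns to y = x + k.
findPos : ℕ → ℕ → ℕ → ℕ → List Row → ℕ
findPos k c a i [] = i
findPos k c a i (r ∷ rs) =
  if ⌊ diag r ≤? k ⌋ ∧ ⌊ k ≤? suc a ⌋ then i
  else if ⌊ diag r ≟ suc k ⌋ ∧ not (marked r) ∧ ⌊ c <? car r ⌋ then i
  else findPos k c (diag r) (suc i) rs

isStart : ℕ → ℕ → Row → Bool
isStart k c x =
  not (marked x) ∧
    ((⌊ diag x ≟ k ⌋ ∧ ⌊ car x <? c ⌋) ∨ (⌊ diag x ≟ suc k ⌋ ∧ ⌊ c <? car x ⌋))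

insertPositions : ℕ → ℕ → ℕ → List Row → List ℕ
insertPositions k c i [] = []
insertPositions k c i (x ∷ xs) with isStart k c x
... | true  = findPos k c (diag x) (suc i) xs ∷ insertPositions k c (suc i) xs
... | false = insertPositions k c (suc i) xs

-- Insert*(MPF, c, k): one marked parking function per starting car
-- (as a list, i.e. the family indexed by the starting cars).
insertStar : List Row → ℕ → ℕ → List (List Row)
insertStar rs c k = map (λ p → insRow p (row c k true) rs) (insertPositions k c 0 rs)

-- Generating functions in t, q as multisets (lists up to permutation) of
-- monomials t^a q^d, represented by exponent pairs (a , d).

Monomial : Set
Monomial = ℕ × ℤ

gfAreaDinv : List (List Row) → List Monomial
gfAreaDinv S = map (λ m → area m , dinv m) S

tqBracket : ℕ → ℤ → ℕ → List Monomial
tqBracket a d m = map (λ i → a , d ℤ.+ ℤ.+ i) (upTo m)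

module Submission where

-- Every element of
-- Insert*(MPF, c, k) is MPF with one marked row, carrying c in the
-- k-diagonal, inserted at some position p.  Such an insertion
--   * raises the area by k and the number of marked valleys by one, and
--   * raises the diagonal inversions by the number of starting cars (unmarked
--     s < c in the k-diagonal, unmarked b > c in the (k+1)-diagonal) below p,
--     since these are exactly the rows forming an inversion with the new car,
-- so its monomial is t^(area + k) q^(dinv − 1 + #starts below p).
-- The second ingredient is that the scan to the right of a starting car
-- stops before (or at) the next starting car, by the Dyck path condition.
-- Hence the insertion begun at the j-th starting car has exactly j starting
-- cars below it, and the j = 1 … m insertions give t^(area+k) q^dinv [m]_q.

open import Defs
open import Data.Nat using (ℕ; _≤_; _<_; _+_)
open import Data.Bool using (true)
open import Data.List using (List; map; length)
open import Data.List.Relation.Unary.All using (All)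
open import Data.List.Membership.Propositional using (_∉_)
open import Data.List.Relation.Binary.Permutation.Propositional using (_↭_)
open import Relation.Binary.PropositionalEquality using (_≡_)
open import Relation.Nullary using (¬_)

open import Data.Nat using (zero; suc; _≟_; _<?_; _≤?_)
open import Data.Nat.Properties using (≤-refl; 1+n≢n; +-assoc; +-comm; +-commutativeSemigroup)
open import Data.Nat.ListAction using (sum)
open import Data.Nat.ListAction.Properties using (sum-++)
open import Data.Bool using (false; if_then_else_; _∧_; not)
open import Data.List using ([]; _∷_; take; drop; _++_; applyUpTo)
open import Data.List.Properties
  using (map-++; map-∘; map-cong; map-id; length-map; map-applyUpTo; map-upTo; take++drop≡id)
open import Data.List.Relation.Unary.Linked as Linked using (Linked; _∷_)
open import Data.List.Relation.Binary.Permutation.Propositional using (↭-reflexive)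
open import Data.Integer as ℤ using (ℤ)
open import Data.Integer.Properties using (pos-+)
open import Data.Integer.Tactic.RingSolver using (solve-∀)
open import Data.Product using (_,_; proj₁)
open import Data.Sum using (_⊎_; inj₁; inj₂)
open import Data.Empty using (⊥-elim)
open import Function using (_∘_)
open import Relation.Binary.PropositionalEquality
  using (refl; sym; trans; cong; cong₂; module ≡-Reasoning)
open import Relation.Nullary using (yes; no)
open import Relation.Nullary.Decidable using (Dec; ⌊_⌋; dec-true; isYes≗does)
open import Algebra.Properties.CommutativeSemigroup +-commutativeSemigroup using (interchange)

open ≡-Reasoning

sum-map-insRow : ∀ (f : Row → ℕ) p x rs →
  sum (map f (insRow p x rs)) ≡ f x + sum (map f rs)
sum-map-insRow f p x rs = begin
  sum (map f (take p rs ++ x ∷ drop p rs))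
    ≡⟨ cong sum (map-++ f (take p rs) (x ∷ drop p rs)) ⟩
  sum (map f (take p rs) ++ f x ∷ map f (drop p rs))
    ≡⟨ sum-++ (map f (take p rs)) _ ⟩
  sum (map f (take p rs)) + (f x + sum (map f (drop p rs)))
    ≡⟨ sym (+-assoc (sum (map f (take p rs))) (f x) _) ⟩
  sum (map f (take p rs)) + f x + sum (map f (drop p rs))
    ≡⟨ cong (_+ sum (map f (drop p rs))) (+-comm (sum (map f (take p rs))) (f x)) ⟩
  f x + sum (map f (take p rs)) + sum (map f (drop p rs))
    ≡⟨ +-assoc (f x) _ _ ⟩
  f x + (sum (map f (take p rs)) + sum (map f (drop p rs)))
    ≡⟨ cong (f x +_) (sym (sum-++ (map f (take p rs)) _)) ⟩
  f x + sum (map f (take p rs) ++ map f (drop p rs))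
    ≡⟨ cong (λ l → f x + sum l) (sym (map-++ f (take p rs) (drop p rs))) ⟩
  f x + sum (map f (take p rs ++ drop p rs))
    ≡⟨ cong (λ l → f x + sum (map f l)) (take++drop≡id p rs) ⟩
  f x + sum (map f rs) ∎

markBit : Row → ℕ
markBit r = if marked r then 1 else 0

markedValleys-sum : ∀ rs → markedValleys rs ≡ sum (map markBit rs)
markedValleys-sum []       = refl
markedValleys-sum (r ∷ rs) = cong (markBit r +_) (markedValleys-sum rs)

area-insRow : ∀ p x rs → area (insRow p x rs) ≡ diag x + area rs
area-insRow = sum-map-insRow diag

markedValleys-insRow : ∀ p x rs →
  markedValleys (insRow p x rs) ≡ markBit x + markedValleys rs
markedValleys-insRow p x rs = begin
  markedValleys (insRow p x rs)       ≡⟨ markedValleys-sum (insRow p x rs) ⟩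
  sum (map markBit (insRow p x rs))   ≡⟨ sum-map-insRow markBit p x rs ⟩
  markBit x + sum (map markBit rs)    ≡⟨ cong (markBit x +_) (sym (markedValleys-sum rs)) ⟩
  markBit x + markedValleys rs        ∎

marked-no-dinv : ∀ x rs → marked x ≡ true → sum (map (pairDinv x) rs) ≡ 0
marked-no-dinv x []       _ = refl
marked-no-dinv (row cx dx true) (r ∷ rs) refl = marked-no-dinv (row cx dx true) rs refl

diagInv-insRow : ∀ p x rs → marked x ≡ true →
  diagInv (insRow p x rs) ≡ sum (map (λ r → pairDinv r x) (take p rs)) + diagInv rs
diagInv-insRow zero    x rs       mx = cong (_+ diagInv rs) (marked-no-dinv x rs mx)
diagInv-insRow (suc p) x []       mx = refl
diagInv-insRow (suc p) x (r ∷ rs) mx = begin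
  sum (map (pairDinv r) (insRow p x rs)) + diagInv (insRow p x rs)
    ≡⟨ cong₂ _+_ (sum-map-insRow (pairDinv r) p x rs) (diagInv-insRow p x rs mx) ⟩
  (pairDinv r x + sum (map (pairDinv r) rs)) + (below + diagInv rs)
    ≡⟨ interchange (pairDinv r x) _ below _ ⟩
  (pairDinv r x + below) + (sum (map (pairDinv r) rs) + diagInv rs) ∎
  where below = sum (map (λ r → pairDinv r x) (take p rs))

shifted-difference : ∀ j D M →
  ℤ.+ (j + D) ℤ.- ℤ.+ (1 + M) ≡ (ℤ.+ D ℤ.- ℤ.+ M) ℤ.+ (ℤ.+ j ℤ.- ℤ.1ℤ)
shifted-difference j D M rewrite pos-+ j D | pos-+ 1 M = ring (ℤ.+ j) (ℤ.+ D) (ℤ.+ M)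
  where
  ring : ∀ (j D M : ℤ) → (j ℤ.+ D) ℤ.- (ℤ.1ℤ ℤ.+ M) ≡ (D ℤ.- M) ℤ.+ (j ℤ.- ℤ.1ℤ)
  ring = solve-∀

⌊⌋-true : ∀ {A : Set} (a? : Dec A) → A → ⌊ a? ⌋ ≡ true
⌊⌋-true a? a = trans (isYes≗does a?) (dec-true a? a)

if-stops-first : ∀ {b} (e : ℕ) {i : ℕ} → b ≡ true → (if b then i else e) ≡ i
if-stops-first _ refl = refl

if-stops-second : ∀ {b b'} (e : ℕ) {i : ℕ} → b' ≡ true →
  (if b then i else (if b' then i else e)) ≡ i
if-stops-second {true}  _ _    = refl
if-stops-second {false} _ refl = refl

-- The only part of the Dyck path condition the insertion positions rely on.
DyckStep : Row → Row → Set
DyckStep p q = diag q ≤ suc (diag p)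

module Insertion (k c : ℕ) where

  newRow : Row
  newRow = row c k true

  startBit : Row → ℕ
  startBit r = if isStart k c r then 1 else 0

  starts : List Row → ℕ
  starts rs = sum (map startBit rs)

  startsBelow : List Row → ℕ → ℕ
  startsBelow rs p = starts (take p rs)

  -- A row below the new car forms a diagonal inversion with it exactly when
  -- it is a starting car: an unmarked smaller car in the k-diagonal is a
  -- primary inversion, an unmarked larger car in the (k+1)-diagonal a
  -- secondary one.
  pairDinv-newRow : ∀ r → pairDinv r newRow ≡ startBit r
  pairDinv-newRow (row cr d true) = refl
  pairDinv-newRow (row cr d false) with d ≟ k | d ≟ suc k | cr <? c | c <? cr
  ... | yes refl | yes k≡1+k | _     | _     = ⊥-elim (1+n≢n (sym k≡1+k))
  ... | yes refl | no _      | yes _ | _     = refl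
  ... | yes refl | no _      | no _  | _     = refl
  ... | no _     | yes refl  | _     | yes _ = refl
  ... | no _     | yes refl  | _     | no _  = refl
  ... | no _     | no _      | _     | _     = refl

  area-insert : ∀ p rs → area (insRow p newRow rs) ≡ area rs + k
  area-insert p rs = trans (area-insRow p newRow rs) (+-comm k (area rs))

  diagInv-insert : ∀ p rs → diagInv (insRow p newRow rs) ≡ startsBelow rs p + diagInv rs
  diagInv-insert p rs = begin
    diagInv (insRow p newRow rs)
      ≡⟨ diagInv-insRow p newRow rs refl ⟩
    sum (map (λ r → pairDinv r newRow) (take p rs)) + diagInv rs
      ≡⟨ cong (λ l → sum l + diagInv rs) (map-cong pairDinv-newRow (take p rs)) ⟩
    startsBelow rs p + diagInv rs ∎

  dinv-insert : ∀ p rs →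
    dinv (insRow p newRow rs) ≡ dinv rs ℤ.+ (ℤ.+ startsBelow rs p ℤ.- ℤ.1ℤ)
  dinv-insert p rs = begin
    ℤ.+ diagInv (insRow p newRow rs) ℤ.- ℤ.+ markedValleys (insRow p newRow rs)
      ≡⟨ cong₂ (λ i m → ℤ.+ i ℤ.- ℤ.+ m) (diagInv-insert p rs) (markedValleys-insRow p newRow rs) ⟩
    ℤ.+ (startsBelow rs p + diagInv rs) ℤ.- ℤ.+ (1 + markedValleys rs)
      ≡⟨ shifted-difference (startsBelow rs p) (diagInv rs) (markedValleys rs) ⟩
    dinv rs ℤ.+ (ℤ.+ startsBelow rs p ℤ.- ℤ.1ℤ) ∎

  findPos-step : ∀ a i r rs →
    findPos k c a i (r ∷ rs) ≡ i ⊎ findPos k c a i (r ∷ rs) ≡ findPos k c (diag r) (suc i) rs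
  findPos-step a i r rs with ⌊ diag r ≤? k ⌋ ∧ ⌊ k ≤? suc a ⌋
  ... | true  = inj₁ refl
  ... | false with ⌊ diag r ≟ suc k ⌋ ∧ not (marked r) ∧ ⌊ c <? car r ⌋
  ...   | true  = inj₁ refl
  ...   | false = inj₂ refl

  findPos-shift : ∀ a i rs → findPos k c a (suc i) rs ≡ suc (findPos k c a i rs)
  findPos-shift a i [] = refl
  findPos-shift a i (r ∷ rs) with ⌊ diag r ≤? k ⌋ ∧ ⌊ k ≤? suc a ⌋
  ... | true  = refl
  ... | false with ⌊ diag r ≟ suc k ⌋ ∧ not (marked r) ∧ ⌊ c <? car r ⌋
  ...   | true  = refl
  ...   | false = findPos-shift (diag r) (suc i) rs

  -- The scan never passes a starting car: a starting car in the k-diagonal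
  -- lies where the path returns to y = x + k, and one in the (k+1)-diagonal
  -- is itself an unmarked car b' > c in the (k+1)-diagonal.
  findPos-stops-at-start : ∀ a i r rs → diag r ≤ suc a → isStart k c r ≡ true →
    findPos k c a i (r ∷ rs) ≡ i
  findPos-stops-at-start a i (row cr d true) rs _ ()
  findPos-stops-at-start a i (row cr d false) rs d≤1+a start
    with d ≟ k | d ≟ suc k | c <? cr
  ... | yes refl | _ | _ =
    if-stops-first _ (cong₂ _∧_ (⌊⌋-true (k ≤? k) ≤-refl) (⌊⌋-true (k ≤? suc a) d≤1+a))
  ... | no _ | yes refl | yes _ =
    if-stops-second {⌊ suc k ≤? k ⌋ ∧ ⌊ k ≤? suc a ⌋} (findPos k c (suc k) (suc i) rs) refl
  ... | no _ | yes refl | no _ with () ← start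
  ... | no _ | no _     | _    with () ← start

  startsBelow-findPos : ∀ x rs → Linked DyckStep (x ∷ rs) →
    startsBelow rs (findPos k c (diag x) 0 rs) ≡ 0
  startsBelow-findPos x []       _       = refl
  startsBelow-findPos x (r ∷ rs) (h ∷ l) with isStart k c r in start
  ... | true  rewrite findPos-stops-at-start (diag x) 0 r rs h start = refl
  ... | false with findPos-step (diag x) 0 r rs
  ...   | inj₁ stop rewrite stop = refl
  ...   | inj₂ next rewrite next | findPos-shift (diag r) 0 rs | start =
    startsBelow-findPos r rs l

  insertPositions-shift : ∀ i rs →
    insertPositions k c (suc i) rs ≡ map suc (insertPositions k c i rs)
  insertPositions-shift i [] = refl
  insertPositions-shift i (x ∷ xs) with isStart k c x
  ... | true  = cong₂ _∷_ (findPos-shift (diag x) (suc i) xs) (insertPositions-shift (suc i) xs)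
  ... | false = insertPositions-shift (suc i) xs

  length-insertPositions : ∀ i rs → length (insertPositions k c i rs) ≡ starts rs
  length-insertPositions i [] = refl
  length-insertPositions i (x ∷ xs) with isStart k c x
  ... | true  = cong suc (length-insertPositions (suc i) xs)
  ... | false = length-insertPositions (suc i) xs

  startsBelow-suc : ∀ x xs ps →
    map (startsBelow (x ∷ xs)) (map suc ps) ≡ map (startBit x +_) (map (startsBelow xs) ps)
  startsBelow-suc x xs ps = trans (sym (map-∘ ps)) (map-∘ ps)

  startsBelow-insertPositions : ∀ rs → Linked DyckStep rs →
    map (startsBelow rs) (insertPositions k c 0 rs) ≡ applyUpTo suc (starts rs)
  startsBelow-insertPositions [] _ = refl
  startsBelow-insertPositions (x ∷ xs) dyck with isStart k c x in start
  ... | true = begin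
    map (startsBelow (x ∷ xs)) (findPos k c (diag x) 1 xs ∷ insertPositions k c 1 xs)
      ≡⟨ cong₂ (λ p ps → map (startsBelow (x ∷ xs)) (p ∷ ps))
               (findPos-shift (diag x) 0 xs) (insertPositions-shift 0 xs) ⟩
    startBit x + startsBelow xs (findPos k c (diag x) 0 xs)
      ∷ map (startsBelow (x ∷ xs)) (map suc positions)
      ≡⟨ cong₂ _∷_ (cong (startBit x +_) (startsBelow-findPos x xs dyck))
                   (startsBelow-suc x xs positions) ⟩
    startBit x + 0 ∷ map (startBit x +_) (map (startsBelow xs) positions)
      ≡⟨ cong (λ b → b + 0 ∷ map (b +_) (map (startsBelow xs) positions)) bit ⟩
    1 ∷ map suc (map (startsBelow xs) positions)
      ≡⟨ cong (λ l → 1 ∷ map suc l) rest ⟩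
    1 ∷ map suc (applyUpTo suc (starts xs))
      ≡⟨ cong (1 ∷_) (map-applyUpTo suc suc (starts xs)) ⟩
    applyUpTo suc (1 + starts xs) ∎
    where
    positions : List ℕ
    positions = insertPositions k c 0 xs
    bit : startBit x ≡ 1
    bit = cong (λ b → if b then 1 else 0) start
    rest : map (startsBelow xs) positions ≡ applyUpTo suc (starts xs)
    rest = startsBelow-insertPositions xs (Linked.tail dyck)
  ... | false = begin
    map (startsBelow (x ∷ xs)) (insertPositions k c 1 xs)
      ≡⟨ cong (map (startsBelow (x ∷ xs))) (insertPositions-shift 0 xs) ⟩
    map (startsBelow (x ∷ xs)) (map suc positions)
      ≡⟨ startsBelow-suc x xs positions ⟩
    map (startBit x +_) (map (startsBelow xs) positions)
      ≡⟨ cong (λ b → map (b +_) (map (startsBelow xs) positions)) bit ⟩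
    map (0 +_) (map (startsBelow xs) positions)
      ≡⟨ map-id (map (startsBelow xs) positions) ⟩
    map (startsBelow xs) positions
      ≡⟨ startsBelow-insertPositions xs (Linked.tail dyck) ⟩
    applyUpTo suc (starts xs) ∎
    where
    positions : List ℕ
    positions = insertPositions k c 0 xs
    bit : startBit x ≡ 0
    bit = cong (λ b → if b then 1 else 0) start

  monomial : List Row → ℕ → Monomial
  monomial rs j = area rs + k , dinv rs ℤ.+ (ℤ.+ j ℤ.- ℤ.1ℤ)

  insert-monomial : ∀ rs p →
    (area (insRow p newRow rs) , dinv (insRow p newRow rs)) ≡ monomial rs (startsBelow rs p)
  insert-monomial rs p = cong₂ _,_ (area-insert p rs) (dinv-insert p rs)

lemma3p8 : (mpf : List Row) → IsMPF mpf →
    (c : ℕ) → 1 ≤ c → c ∉ map car mpf →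
    (k : ℕ) →
    All (λ r → diag r ≡ k → marked r ≡ true → ¬ (car r < c)) mpf →
    gfAreaDinv (insertStar mpf c k)
      ↭ tqBracket (area mpf + k) (dinv mpf) (length (insertStar mpf c k))
lemma3p8 mpf isMPF c _ _ k _ = ↭-reflexive (begin
  map (λ m → area m , dinv m) (map (λ p → insRow p newRow mpf) positions)
    ≡⟨ sym (map-∘ positions) ⟩
  map (λ p → area (insRow p newRow mpf) , dinv (insRow p newRow mpf)) positions
    ≡⟨ map-cong (insert-monomial mpf) positions ⟩
  map (monomial mpf ∘ startsBelow mpf) positions
    ≡⟨ map-∘ positions ⟩
  map (monomial mpf) (map (startsBelow mpf) positions)
    ≡⟨ cong (map (monomial mpf)) (startsBelow-insertPositions mpf dyck) ⟩
  map (monomial mpf) (applyUpTo suc (starts mpf))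
    ≡⟨ map-applyUpTo suc (monomial mpf) (starts mpf) ⟩
  applyUpTo (λ i → area mpf + k , dinv mpf ℤ.+ ℤ.+ i) (starts mpf)
    ≡⟨ sym (map-upTo (λ i → area mpf + k , dinv mpf ℤ.+ ℤ.+ i) (starts mpf)) ⟩
  tqBracket (area mpf + k) (dinv mpf) (starts mpf)
    ≡⟨ cong (tqBracket (area mpf + k) (dinv mpf)) (sym size) ⟩
  tqBracket (area mpf + k) (dinv mpf) (length (insertStar mpf c k)) ∎)
  where
  open Insertion k c
  positions : List ℕ
  positions = insertPositions k c 0 mpf
  dyck : Linked DyckStep mpf
  dyck = Linked.map proj₁ (IsMPF.steps isMPF)
  size : length (insertStar mpf c k) ≡ starts mpf
  size = trans (length-map (λ p → insRow p newRow mpf) positions) (length-insertPositions 0 mpf)
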